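{- Let $m,n$ be positive integers with $n \geqslant 2$, and let $v \in V(P_{2n-1})$ and $w \in V(P_{2n-1+2^m})$ both be $c$-central vertices. (i) If $c = n-1$ then $\left[ A(P_{2n-1})^{n} \mathbf 1 \right]_v = 2^n - 2$, $\left[A(P_{2n-1})^{2n}\right]_{v,v} = \binom{2n}{n} - 2$, $\left[ A(P_{2n-1+2^m})^{n} \mathbf 1 \right]_w = 2^n - 1$, and $\left[ A(P_{2n-1+2^m})^{2n} \right]_{w,w} = \binom{2n}{n} - 1$. (ii) If $c < n-1$ and $k\leqslant n$ then $\left[ A(P_{2n-1})^{k} \mathbf 1 \right]_v = \left[ A(P_{2n-1+2^m})^{k} \mathbf 1 \right]_w$. (iii) If $c \leqslant n-1$ and $k \leqslant 2n-1$ then $\left[ A(P_{2n-1})^k\right]_{v,v} = \left[A(P_{2n-1+2^m})^k\right]_{w,w}$. (iv) If $c < n-1$ then $\left[A(P_{2n-1})^{2n}\right]_{v,v} = \left[A(P_{2n-1+2^m})^{2n}\right]_{w,w}$.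
   Context: Here $k$ denotes a nonnegative integer. $P_N$ is the path graph with vertex set $\{0,1,\dots,N-1\}$ in which $i$ and $i+1$ are adjacent for $i\in\{0,\dots,N-2\}$; $A(P_N)$ is its adjacency matrix and $\mathbf 1$ the all-ones vector. For a nonnegative integer $c$, a vertex $v$ of $P_N$ is $c$-central if the minimum distance from $v$ to a leaf (the vertices $0$ and $N-1$) is $c$. -}

module Defs where

open import Data.Nat using (ℕ; zero; suc; _+_; _*_; _∸_; _⊓_)
open import Data.Fin using (Fin; toℕ)
import Data.Fin as F
open import Data.Nat using (_≟_)
open import Relation.Nullary using (yes; no)
open import Data.Bool using (true; false)
open import Relation.Binary.PropositionalEquality using (_≡_)

ΣFin : (N : ℕ) → (Fin N → ℕ) → ℕ
ΣFin zero    f = 0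
ΣFin (suc N) f = f F.zero + ΣFin N (λ i → f (F.suc i))

Matrix : ℕ → Set
Matrix N = Fin N → Fin N → ℕ

δ : ℕ → ℕ → ℕ
δ a b with a ≟ b
... | yes _ = 1
... | no  _ = 0

adjP : (N : ℕ) → Matrix N
adjP N i j = δ (suc (toℕ i)) (toℕ j) + δ (suc (toℕ j)) (toℕ i)

idM : (N : ℕ) → Matrix N
idM N i j = δ (toℕ i) (toℕ j)

_·M_ : {N : ℕ} → Matrix N → Matrix N → Matrix N
_·M_ {N} A B i j = ΣFin N (λ l → A i l * B l j)

_^M_ : {N : ℕ} → Matrix N → ℕ → Matrix N
_^M_ {N} A zero    = idM N
_^M_ {N} A (suc k) = A ·M (A ^M k)

_·𝟏 : {N : ℕ} → Matrix N → Fin N → ℕ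
_·𝟏 {N} M v = ΣFin N (λ j → M v j)

-- distance from v to the nearest leaf (0 or N-1) in P_N (path distance is |i-j|)
leafDist : (N : ℕ) → Fin N → ℕ
leafDist N v = toℕ v ⊓ ((N ∸ 1) ∸ toℕ v)

Central : (N : ℕ) → ℕ → Fin N → Set
Central N c v = leafDist N v ≡ c

-- [A(P_N)^k]_{ij} counts walks of length k from i to j. Reflecting P_N moves every
-- c-central vertex to c, and a walk of length k from c only sees the vertices up to
-- c + k (up to (2c + k)/2 if it returns to c); while these stay below N, the path looks
-- like the half-line ℕ. On the half-line the counts are binomial coefficients as long as
-- the leaf cannot be passed, and at the first length where it can, exactly one walk
-- (straight down past the leaf and back) is lost. The midpoint n − 1 of P_{2n−1} loses
-- one walk at each of its two leaves; in P_{2n−1+2^m} the far leaf is out of reach.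

{-# OPTIONS --safe #-}
module Submission where

open import Defs
open import Data.Nat
  using (ℕ; zero; suc; _+_; _*_; _∸_; _^_; _≤_; _<_; z≤n; s≤s; s≤s⁻¹; _≟_; _<?_; _≤?_)
open import Data.Nat.Properties
open import Data.Nat.Combinatorics
  using (_C_; nCk≡nC[n∸k]; nCk+nC[k+1]≡[n+1]C[k+1]; nCn≡1; k>n⇒nCk≡0)
open import Data.Nat.GeneralisedArithmetic using (fold)
open import Data.Nat.Tactic.RingSolver using (solve-∀)
open import Algebra.Properties.CommutativeSemigroup +-commutativeSemigroup using (interchange)
open import Data.Fin using (Fin; toℕ) renaming (zero to fzero; suc to fsuc)
open import Data.Fin.Properties using (toℕ<n)
open import Data.Product using (_×_; _,_)
open import Data.Sum using (_⊎_; inj₁; inj₂)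
open import Function using (_∘_; const)
open import Relation.Nullary using (yes; no; contradiction)
open import Relation.Binary.PropositionalEquality
  using (_≡_; _≢_; refl; sym; trans; cong; cong₂; subst; module ≡-Reasoning)
open ≡-Reasoning

δ-≡ : ∀ {a b} → a ≡ b → δ a b ≡ 1
δ-≡ {a} {b} a≡b with a ≟ b
... | yes _   = refl
... | no a≢b = contradiction a≡b a≢b

δ-≢ : ∀ {a b} → a ≢ b → δ a b ≡ 0
δ-≢ {a} {b} a≢b with a ≟ b
... | yes a≡b = contradiction a≡b a≢b
... | no _    = refl

δ-cong-⇔ : ∀ {a b a′ b′} → (a ≡ b → a′ ≡ b′) → (a′ ≡ b′ → a ≡ b) →
  δ a b ≡ δ a′ b′
δ-cong-⇔ {a} {b} to from with a ≟ b
... | yes a≡b = sym (δ-≡ (to a≡b))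
... | no a≢b  = sym (δ-≢ (a≢b ∘ from))

δ-suc : ∀ a b → δ (suc a) (suc b) ≡ δ a b
δ-suc a b = δ-cong-⇔ suc-injective (cong suc)

δ-sym : ∀ a b → δ a b ≡ δ b a
δ-sym a b = δ-cong-⇔ sym sym

δ[_] : ℕ → ℕ → ℕ
δ[ j ] i = δ i j

ΣFin-cong : ∀ N {f g : Fin N → ℕ} → (∀ l → f l ≡ g l) → ΣFin N f ≡ ΣFin N g
ΣFin-cong zero    f≗g = refl
ΣFin-cong (suc N) f≗g = cong₂ _+_ (f≗g fzero) (ΣFin-cong N (f≗g ∘ fsuc))

ΣFin-zero : ∀ N {f : Fin N → ℕ} → (∀ l → f l ≡ 0) → ΣFin N f ≡ 0
ΣFin-zero zero    f≗0 = refl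
ΣFin-zero (suc N) f≗0 = cong₂ _+_ (f≗0 fzero) (ΣFin-zero N (f≗0 ∘ fsuc))

ΣFin-distrib-+ : ∀ N (f g : Fin N → ℕ) → ΣFin N (λ l → f l + g l) ≡ ΣFin N f + ΣFin N g
ΣFin-distrib-+ zero    f g = refl
ΣFin-distrib-+ (suc N) f g =
  trans (cong (f fzero + g fzero +_) (ΣFin-distrib-+ N (f ∘ fsuc) (g ∘ fsuc)))
        (interchange (f fzero) (g fzero) _ _)

onPath : ℕ → (ℕ → ℕ) → ℕ → ℕ
onPath zero    g a       = 0
onPath (suc N) g zero    = g 0
onPath (suc N) g (suc a) = onPath N (g ∘ suc) a

onPath-< : ∀ {N a} g → a < N → onPath N g a ≡ g a
onPath-< {suc N} {zero}  g _         = refl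
onPath-< {suc N} {suc a} g (s≤s a<N) = onPath-< (g ∘ suc) a<N

onPath-≥ : ∀ {N a} g → N ≤ a → onPath N g a ≡ 0
onPath-≥ {zero}          g _         = refl
onPath-≥ {suc N} {suc a} g (s≤s N≤a) = onPath-≥ (g ∘ suc) N≤a

onPath-cong : ∀ N {g g′} → (∀ {x} → x < N → g x ≡ g′ x) → ∀ a → onPath N g a ≡ onPath N g′ a
onPath-cong zero    _    a       = refl
onPath-cong (suc N) g≗g′ zero    = g≗g′ (s≤s z≤n)
onPath-cong (suc N) g≗g′ (suc a) = onPath-cong N (g≗g′ ∘ s≤s) a

ΣFin-onPath : ∀ N M (F : Fin M → ℕ → ℕ) a →
  ΣFin M (λ j → onPath N (F j) a) ≡ onPath N (λ x → ΣFin M (λ j → F j x)) a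
ΣFin-onPath zero    M F a       = ΣFin-zero M (λ _ → refl)
ΣFin-onPath (suc N) M F zero    = refl
ΣFin-onPath (suc N) M F (suc a) = ΣFin-onPath N M (λ j → F j ∘ suc) a

ΣFin-δ : ∀ N a (g : ℕ → ℕ) → ΣFin N (λ l → δ a (toℕ l) * g (toℕ l)) ≡ onPath N g a
ΣFin-δ zero    a       g = refl
ΣFin-δ (suc N) zero    g =
  trans (cong₂ _+_ (cong (_* g 0) (δ-≡ {0} refl))
                   (ΣFin-zero N λ l → cong (_* g (suc (toℕ l))) (δ-≢ {0} (0≢1+n {toℕ l}))))
        (trans (+-identityʳ _) (*-identityˡ _))
ΣFin-δ (suc N) (suc a) g =
  trans (cong₂ _+_ (cong (_* g 0) (δ-≢ {suc a} 1+n≢0))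
                   (ΣFin-cong N λ l → cong (_* g (suc (toℕ l))) (δ-suc a (toℕ l))))
        (ΣFin-δ N a (g ∘ suc))

ΣFin-δ≡1 : ∀ N {x} → x < N → ΣFin N (λ j → δ x (toℕ j)) ≡ 1
ΣFin-δ≡1 N {x} x<N =
  trans (ΣFin-cong N (λ j → sym (*-identityʳ _))) (trans (ΣFin-δ N x (const 1)) (onPath-< _ x<N))

below : (ℕ → ℕ) → ℕ → ℕ
below g zero    = 0
below g (suc i) = g i

halfLineAdj : (ℕ → ℕ) → ℕ → ℕ
halfLineAdj g i = g (suc i) + below g i

-- A(P_N) acting on ℕ → ℕ: (pathAdj N g) i = g (i + 1) + g (i − 1), with g (−1) and g N read
-- as 0; halfLineAdj is the same operator for the half-line, which has no second leaf.
pathAdj : ℕ → (ℕ → ℕ) → ℕ → ℕ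
pathAdj N g = halfLineAdj (onPath N g)

walksFrom : ((ℕ → ℕ) → ℕ → ℕ) → ℕ → ℕ → ℕ
walksFrom A k = fold (const 1) A k

walks : ((ℕ → ℕ) → ℕ → ℕ) → ℕ → ℕ → ℕ → ℕ
walks A k i j = fold δ[ j ] A k i

halfLineAdj-cong : ∀ {g g′} i → (∀ {x} → x ≤ suc i → g x ≡ g′ x) →
  halfLineAdj g i ≡ halfLineAdj g′ i
halfLineAdj-cong zero    g≗g′ = cong (_+ 0) (g≗g′ ≤-refl)
halfLineAdj-cong (suc i) g≗g′ = cong₂ _+_ (g≗g′ ≤-refl) (g≗g′ (m≤n⇒m≤1+n (n≤1+n i)))

pathAdj-cong : ∀ N {g g′} → (∀ {x} → x < N → g x ≡ g′ x) → ∀ i → pathAdj N g i ≡ pathAdj N g′ i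
pathAdj-cong N g≗g′ i = halfLineAdj-cong i (λ {x} _ → onPath-cong N g≗g′ x)

ΣFin-δ-below : ∀ N i (g : ℕ → ℕ) →
  ΣFin N (λ l → δ (suc (toℕ l)) i * g (toℕ l)) ≡ below (onPath N g) i
ΣFin-δ-below N zero    g = ΣFin-zero N (λ l → cong (_* g (toℕ l)) (δ-≢ {suc (toℕ l)} 1+n≢0))
ΣFin-δ-below N (suc a) g =
  trans (ΣFin-cong N λ l → cong (_* g (toℕ l)) (trans (δ-suc (toℕ l) a) (δ-sym (toℕ l) a)))
        (ΣFin-δ N a g)

ΣFin-adjP : ∀ N (i : Fin N) (g : ℕ → ℕ) →
  ΣFin N (λ l → adjP N i l * g (toℕ l)) ≡ pathAdj N g (toℕ i)
ΣFin-adjP N i g =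
  trans (ΣFin-cong N λ l →
           *-distribʳ-+ (g (toℕ l)) (δ (suc (toℕ i)) (toℕ l)) (δ (suc (toℕ l)) (toℕ i)))
  (trans (ΣFin-distrib-+ N _ _)
         (cong₂ _+_ (ΣFin-δ N (suc (toℕ i)) g) (ΣFin-δ-below N (toℕ i) g)))

adjP^M≡walks : ∀ N k (i j : Fin N) → (adjP N ^M k) i j ≡ walks (pathAdj N) k (toℕ i) (toℕ j)
adjP^M≡walks N zero    i j = refl
adjP^M≡walks N (suc k) i j =
  trans (ΣFin-cong N λ l → cong (adjP N i l *_) (adjP^M≡walks N k l j)) (ΣFin-adjP N i _)

ΣFin-halfLineAdj : ∀ M (F : Fin M → ℕ → ℕ) i →
  ΣFin M (λ j → halfLineAdj (F j) i) ≡ halfLineAdj (λ x → ΣFin M (λ j → F j x)) i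
ΣFin-halfLineAdj M F zero    =
  trans (ΣFin-distrib-+ M _ _) (cong (ΣFin M (λ j → F j 1) +_) (ΣFin-zero M (λ _ → refl)))
ΣFin-halfLineAdj M F (suc i) = ΣFin-distrib-+ M _ _

ΣFin-fold-pathAdj : ∀ N M (F : Fin M → ℕ → ℕ) k i →
  ΣFin M (λ j → fold (F j) (pathAdj N) k i) ≡ fold (λ x → ΣFin M (λ j → F j x)) (pathAdj N) k i
ΣFin-fold-pathAdj N M F zero    i = refl
ΣFin-fold-pathAdj N M F (suc k) i =
  trans (ΣFin-halfLineAdj M (λ j → onPath N (fold (F j) (pathAdj N) k)) i)
        (halfLineAdj-cong i λ {x} _ →
          trans (ΣFin-onPath N M (λ j → fold (F j) (pathAdj N) k) x)
                (onPath-cong N (λ {y} _ → ΣFin-fold-pathAdj N M F k y) x))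

fold-pathAdj-cong : ∀ N {g g′} → (∀ {x} → x < N → g x ≡ g′ x) →
  ∀ k {i} → i < N → fold g (pathAdj N) k i ≡ fold g′ (pathAdj N) k i
fold-pathAdj-cong N g≗g′ zero    i<N = g≗g′ i<N
fold-pathAdj-cong N g≗g′ (suc k) {i} _ = pathAdj-cong N (fold-pathAdj-cong N g≗g′ k) i

adjP^M·𝟏≡walksFrom : ∀ N k (i : Fin N) → ((adjP N ^M k) ·𝟏) i ≡ walksFrom (pathAdj N) k (toℕ i)
adjP^M·𝟏≡walksFrom N k i =
  trans (ΣFin-cong N (adjP^M≡walks N k i))
  (trans (ΣFin-fold-pathAdj N N (δ[_] ∘ toℕ) k (toℕ i))
         (fold-pathAdj-cong N (ΣFin-δ≡1 N) k (toℕ<n i)))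

-- x′ = N − 1 − x, written without truncated subtraction.
Reflected : ℕ → (ℕ → ℕ) → (ℕ → ℕ) → Set
Reflected N g g′ = ∀ x x′ → suc (x + x′) ≡ N → g x ≡ g′ x′

mirror-comm : ∀ {N} x x′ → suc (x + x′) ≡ N → suc (x′ + x) ≡ N
mirror-comm x x′ = trans (cong suc (+-comm x′ x))

mirror-<ˡ : ∀ {N} x x′ → suc (x + x′) ≡ N → x < N
mirror-<ˡ x x′ e = subst (x <_) e (s≤s (m≤m+n x x′))

mirror-unique : ∀ {N} x x′ {j j′} → suc (x + x′) ≡ N → suc (j + j′) ≡ N → x ≡ j → x′ ≡ j′
mirror-unique x x′ ex ej refl = +-cancelˡ-≡ x x′ _ (suc-injective (trans ex (sym ej)))

reflected-sym : ∀ {N g g′} → Reflected N g g′ → Reflected N g′ g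
reflected-sym g~g′ x′ x e = sym (g~g′ x x′ (mirror-comm x′ x e))

δ-reflected : ∀ {N} j j′ → suc (j + j′) ≡ N → Reflected N δ[ j ] δ[ j′ ]
δ-reflected j j′ ej x x′ ex =
  δ-cong-⇔ (mirror-unique x x′ ex ej) (mirror-unique x′ x (mirror-comm x x′ ex) (mirror-comm j j′ ej))

onPath-reflected : ∀ {N g g′} → Reflected N g g′ →
  ∀ x x′ → suc (x + x′) ≡ N → onPath N g (suc x) ≡ below (onPath N g′) x′
onPath-reflected {g = g} g~g′ x zero e =
  onPath-≥ g (≤-reflexive (trans (sym e) (cong suc (+-identityʳ x))))
onPath-reflected {N} {g} {g′} g~g′ x (suc y) e = begin
  onPath N g (suc x) ≡⟨ onPath-< g (mirror-<ˡ (suc x) y e′) ⟩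
  g (suc x)          ≡⟨ g~g′ (suc x) y e′ ⟩
  g′ y               ≡⟨ onPath-< g′ (mirror-<ˡ y (suc x) (mirror-comm (suc x) y e′)) ⟨
  onPath N g′ y      ∎
  where
  e′ : suc (suc x + y) ≡ N
  e′ = trans (cong suc (sym (+-suc x y))) e

pathAdj-reflected : ∀ {N g g′} → Reflected N g g′ → Reflected N (pathAdj N g) (pathAdj N g′)
pathAdj-reflected {N} {g} {g′} g~g′ x x′ e =
  trans (cong₂ _+_ (onPath-reflected g~g′ x x′ e)
                   (sym (onPath-reflected (reflected-sym g~g′) x′ x (mirror-comm x x′ e))))
        (+-comm (below (onPath N g′) x′) (onPath N g′ (suc x′)))

fold-pathAdj-reflected : ∀ {N g g′} → Reflected N g g′ →
  ∀ k → Reflected N (fold g (pathAdj N) k) (fold g′ (pathAdj N) k)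
fold-pathAdj-reflected g~g′ zero    = g~g′
fold-pathAdj-reflected g~g′ (suc k) = pathAdj-reflected (fold-pathAdj-reflected g~g′ k)

central-cases : ∀ {N c} (v : Fin N) → Central N c v → toℕ v ≡ c ⊎ suc (toℕ v + c) ≡ N
central-cases {suc N} v refl with ⊓-sel (toℕ v) (N ∸ toℕ v)
... | inj₁ c≡v   = inj₁ (sym c≡v)
... | inj₂ c≡N-v =
  inj₂ (cong suc (trans (cong (toℕ v +_) c≡N-v) (m+[n∸m]≡n (s≤s⁻¹ (toℕ<n v)))))

central-invariant : ∀ {N c} {f : ℕ → ℕ} (v : Fin N) → Reflected N f f → Central N c v →
  f (toℕ v) ≡ f c
central-invariant {f = f} v f~f cv with central-cases v cv
... | inj₁ v≡c   = cong f v≡c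
... | inj₂ v+c+1 = f~f (toℕ v) _ v+c+1

diagonal-central : ∀ {N c} k (v : Fin N) → Central N c v →
  (adjP N ^M k) v v ≡ walks (pathAdj N) k c c
diagonal-central {N} k v cv =
  trans (adjP^M≡walks N k v v)
        (central-invariant {f = λ x → walks (pathAdj N) k x x} v
                           (λ x x′ e → fold-pathAdj-reflected (δ-reflected x x′ e) k x x′ e) cv)

rowSum-central : ∀ {N c} k (v : Fin N) → Central N c v →
  ((adjP N ^M k) ·𝟏) v ≡ walksFrom (pathAdj N) k c
rowSum-central {N} k v cv =
  trans (adjP^M·𝟏≡walksFrom N k v) (central-invariant v (fold-pathAdj-reflected (λ _ _ _ → refl) k) cv)

fold-pathAdj-local : ∀ {N} g k {i} → i + k < N → fold g (pathAdj N) k i ≡ fold g halfLineAdj k i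
fold-pathAdj-local g zero    _ = refl
fold-pathAdj-local {N} g (suc k) {i} i+k<N = halfLineAdj-cong i λ {x} x≤1+i →
  let x+k<N = ≤-<-trans (+-monoˡ-≤ k x≤1+i) (subst (_< N) (+-suc i k) i+k<N)
  in trans (onPath-< _ (≤-<-trans (m≤m+n x k) x+k<N)) (fold-pathAdj-local g k x+k<N)

VanishesAbove : ℕ → (ℕ → ℕ) → Set
VanishesAbove j g = ∀ {x} → j < x → g x ≡ 0

δ-vanishesAbove : ∀ j → VanishesAbove j δ[ j ]
δ-vanishesAbove j j<x = δ-≢ (λ x≡j → <⇒≢ j<x (sym x≡j))

fold-halfLineAdj-vanishesAbove : ∀ {j g} → VanishesAbove j g →
  ∀ k → VanishesAbove (k + j) (fold g halfLineAdj k)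
fold-halfLineAdj-vanishesAbove g↑ zero    = g↑
fold-halfLineAdj-vanishesAbove g↑ (suc k) {suc x} (s≤s k+j<x) =
  cong₂ _+_ (fold-halfLineAdj-vanishesAbove g↑ k (m<n⇒m<1+n (m<n⇒m<1+n k+j<x)))
            (fold-halfLineAdj-vanishesAbove g↑ k k+j<x)

-- A walk of length k from i to a vertex ≤ j never rises above (i + j + k) / 2.
fold-pathAdj-local-vanishing : ∀ N {j g} → VanishesAbove j g →
  ∀ k {i} → i + j + k < N + N → fold g (pathAdj N) k i ≡ fold g halfLineAdj k i
fold-pathAdj-local-vanishing N g↑ zero    _ = refl
fold-pathAdj-local-vanishing N {j} {g} g↑ (suc k) {i} bound = halfLineAdj-cong i agree
  where
  agree : ∀ {x} → x ≤ suc i → onPath N (fold g (pathAdj N) k) x ≡ fold g halfLineAdj k x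
  agree {x} x≤1+i with x <? N
  ... | yes x<N = trans (onPath-< _ x<N) (fold-pathAdj-local-vanishing N g↑ k x+j+k<N+N)
    where
    x+j+k<N+N = ≤-<-trans (+-monoˡ-≤ k (+-monoˡ-≤ j x≤1+i)) (subst (_< N + N) (+-suc (i + j) k) bound)
  ... | no x≮N  = trans (onPath-≥ _ N≤x) (sym (fold-halfLineAdj-vanishesAbove g↑ k k+j<x))
    where
    N≤x = ≮⇒≥ x≮N
    shuffle : ∀ i j k → i + j + suc k ≡ k + j + suc i
    shuffle = solve-∀
    k+j<x : k + j < x
    k+j<x = +-cancelʳ-< (suc i) (k + j) x
      (<-≤-trans (subst (_< N + N) (shuffle i j k) bound) (+-mono-≤ N≤x (≤-trans N≤x x≤1+i)))

2^k+2^k≡2^[1+k] : ∀ k → 2 ^ k + 2 ^ k ≡ 2 ^ suc k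
2^k+2^k≡2^[1+k] k = cong (2 ^ k +_) (sym (+-identityʳ (2 ^ k)))

walksFrom-halfLine-far : ∀ k {i} → k ≤ i → walksFrom halfLineAdj k i ≡ 2 ^ k
walksFrom-halfLine-far zero    _ = refl
walksFrom-halfLine-far (suc k) {suc i} (s≤s k≤i) =
  trans (cong₂ _+_ (walksFrom-halfLine-far k (m≤n⇒m≤1+n (m≤n⇒m≤1+n k≤i))) (walksFrom-halfLine-far k k≤i))
        (2^k+2^k≡2^[1+k] k)

-- Only the walk going straight down falls off the leaf.
walksFrom-halfLine-edge : ∀ k → suc (walksFrom halfLineAdj (suc k) k) ≡ 2 ^ suc k
walksFrom-halfLine-edge zero    = refl
walksFrom-halfLine-edge (suc k) = begin
  suc (walksFrom halfLineAdj (suc k) (suc (suc k)) + walksFrom halfLineAdj (suc k) k)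
    ≡⟨ +-suc _ _ ⟨
  walksFrom halfLineAdj (suc k) (suc (suc k)) + suc (walksFrom halfLineAdj (suc k) k)
    ≡⟨ cong₂ _+_ (walksFrom-halfLine-far (suc k) (n≤1+n (suc k))) (walksFrom-halfLine-edge k) ⟩
  2 ^ suc k + 2 ^ suc k
    ≡⟨ 2^k+2^k≡2^[1+k] (suc k) ⟩
  2 ^ suc (suc k) ∎

m+m≤1+n+n⇒m≤n : ∀ {m n} → m + m ≤ suc (n + n) → m ≤ n
m+m≤1+n+n⇒m≤n {m} {n} m+m≤1+2n with m ≤? n
... | yes m≤n = m≤n
... | no  m≰n = contradiction (≤-trans 2+2n≤m+m m+m≤1+2n) 1+n≰n
  where
  2+2n≤m+m : suc (suc (n + n)) ≤ m + m
  2+2n≤m+m = subst (_≤ m + m) (cong suc (+-suc n n)) (+-mono-≤ (≰⇒> m≰n) (≰⇒> m≰n))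

-- u counts the up-steps; no walk from i to j of length < i + j + 2 can fall off the leaf.
walks-halfLine-binomial : ∀ k u {i j} → k ≤ suc (i + j) → j + k ≡ i + (u + u) →
  walks halfLineAdj k i j ≡ k C u
walks-halfLine-binomial zero zero {i} {j} _ e =
  δ-≡ (trans (sym (+-identityʳ i)) (trans (sym e) (+-identityʳ j)))
walks-halfLine-binomial zero (suc u) {i} {j} _ e =
  δ-≢ λ { refl → 0≢1+n (+-cancelˡ-≡ i 0 (suc u + suc u) e) }
walks-halfLine-binomial (suc k) zero {zero} {j} _ e = contradiction (trans (sym (+-suc j k)) e) 1+n≢0
walks-halfLine-binomial (suc k) (suc u) {zero} {j} (s≤s k≤j) e = begin
  walks halfLineAdj k 1 j + 0 ≡⟨ +-identityʳ _ ⟩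
  walks halfLineAdj k 1 j     ≡⟨ walks-halfLine-binomial k u (m≤n⇒m≤1+n (m≤n⇒m≤1+n k≤j)) e′ ⟩
  k C u                       ≡⟨ +-identityʳ _ ⟨
  k C u + 0                   ≡⟨ cong (k C u +_) (k>n⇒nCk≡0 (s≤s k≤u)) ⟨
  k C u + k C suc u           ≡⟨ nCk+nC[k+1]≡[n+1]C[k+1] k u ⟩
  suc k C suc u               ∎
  where
  e′ : j + k ≡ 1 + (u + u)
  e′ = trans (suc-injective (trans (sym (+-suc j k)) e)) (+-suc u u)
  k≤u : k ≤ u
  k≤u = m+m≤1+n+n⇒m≤n (≤-trans (+-monoˡ-≤ k k≤j) (≤-reflexive e′))
walks-halfLine-binomial (suc k) zero {suc i} {j} k≤1+i+j e =
  cong₂ _+_ (fold-halfLineAdj-vanishesAbove (δ-vanishesAbove j) k k+j<2+i)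
            (walks-halfLine-binomial k 0 (s≤s⁻¹ k≤1+i+j) e′)
  where
  e′ : j + k ≡ i + 0
  e′ = suc-injective (trans (sym (+-suc j k)) e)
  k+j<2+i : k + j < suc (suc i)
  k+j<2+i = s≤s (m≤n⇒m≤1+n (≤-reflexive (trans (+-comm k j) (trans e′ (+-identityʳ i)))))
walks-halfLine-binomial (suc k) (suc u) {suc i} {j} k≤1+i+j e =
  trans (cong₂ _+_ (walks-halfLine-binomial k u (m≤n⇒m≤1+n (m≤n⇒m≤1+n (s≤s⁻¹ k≤1+i+j))) e″)
                   (walks-halfLine-binomial k (suc u) (s≤s⁻¹ k≤1+i+j) e′))
        (nCk+nC[k+1]≡[n+1]C[k+1] k u)
  where
  e′ : j + k ≡ i + (suc u + suc u)
  e′ = suc-injective (trans (sym (+-suc j k)) e)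
  shift : ∀ i u → i + (suc u + suc u) ≡ suc (suc i) + (u + u)
  shift = solve-∀
  e″ : j + k ≡ suc (suc i) + (u + u)
  e″ = trans e′ (shift i u)

-- Exactly one walk of this length falls off the leaf: straight down, then straight up to j.
walks-halfLine-reflection : ∀ i j →
  suc (walks halfLineAdj (suc (suc (i + j))) i j) ≡ suc (suc (i + j)) C suc j
walks-halfLine-reflection zero j = begin
  suc (walks halfLineAdj (suc j) 1 j + 0) ≡⟨ cong suc (+-identityʳ _) ⟩
  suc (walks halfLineAdj (suc j) 1 j)     ≡⟨ cong suc (walks-halfLine-binomial (suc j) j (n≤1+n _) (+-suc j j)) ⟩
  suc (suc j C j)                         ≡⟨ +-comm 1 _ ⟩
  suc j C j + 1                           ≡⟨ cong (suc j C j +_) (nCn≡1 (suc j)) ⟨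
  suc j C j + suc j C suc j               ≡⟨ nCk+nC[k+1]≡[n+1]C[k+1] (suc j) j ⟩
  suc (suc j) C suc j                     ∎
walks-halfLine-reflection (suc i) j = begin
  suc (walks halfLineAdj k (suc (suc i)) j + walks halfLineAdj k i j) ≡⟨ +-suc _ _ ⟨
  walks halfLineAdj k (suc (suc i)) j + suc (walks halfLineAdj k i j)
    ≡⟨ cong₂ _+_ (walks-halfLine-binomial k j (n≤1+n k) (shift i j)) (walks-halfLine-reflection i j) ⟩
  k C j + k C suc j ≡⟨ nCk+nC[k+1]≡[n+1]C[k+1] k j ⟩
  suc k C suc j     ∎
  where
  k = suc (suc (i + j))
  shift : ∀ i j → j + suc (suc (i + j)) ≡ suc (suc i) + (j + j)
  shift = solve-∀

rowSum-halfLine : ∀ {N c k} (v : Fin N) → Central N c v → c + k < N →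
  ((adjP N ^M k) ·𝟏) v ≡ walksFrom halfLineAdj k c
rowSum-halfLine {k = k} v cv c+k<N = trans (rowSum-central k v cv) (fold-pathAdj-local (const 1) k c+k<N)

diagonal-halfLine : ∀ {N c k} (v : Fin N) → Central N c v → c + c + k < N + N →
  (adjP N ^M k) v v ≡ walks halfLineAdj k c c
diagonal-halfLine {N} {c} {k} v cv bound =
  trans (diagonal-central k v cv)
        (fold-pathAdj-local-vanishing N (δ-vanishesAbove c) k bound)

2*[1+q]≡2+q+q : ∀ q → 2 * suc q ≡ suc (suc (q + q))
2*[1+q]≡2+q+q q = cong suc (trans (cong (λ x → q + suc x) (+-identityʳ q)) (+-suc q q))

1+m≡n⇒m+m≡n+n∸2 : ∀ {m n} → suc m ≡ n → m + m ≡ n + n ∸ 2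
1+m≡n⇒m+m≡n+n∸2 {m} refl = sym (cong (_∸ 1) (+-suc m m))

odd-binomial-double : ∀ q → suc (q + q) C suc q + suc (q + q) C suc q ≡ suc (suc (q + q)) C suc q
odd-binomial-double q =
  trans (cong (_+ suc (q + q) C suc q) symmetric) (nCk+nC[k+1]≡[n+1]C[k+1] (suc (q + q)) q)
  where
  symmetric : suc (q + q) C suc q ≡ suc (q + q) C q
  symmetric = trans (nCk≡nC[n∸k] (s≤s (m≤m+n q q))) (cong (suc (q + q) C_) (m+n∸n≡m q q))

p+[1+p]<3+2p : ∀ p → p + suc p < suc (suc (suc (p + p)))
p+[1+p]<3+2p p = s≤s (m≤n⇒m≤1+n (≤-reflexive (+-suc p p)))

pathAdj-midpoint : ∀ p {g} → Reflected (suc (suc (suc (p + p)))) g g →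
  pathAdj (suc (suc (suc (p + p)))) g (suc p) ≡ g p + g p
pathAdj-midpoint p {g} g~g =
  cong₂ _+_ (trans (onPath-< g (s≤s (s≤s (s≤s (m≤m+n p p))))) (g~g (suc (suc p)) p refl))
            (onPath-< g (s≤s (m≤n⇒m≤1+n (m≤n⇒m≤1+n (m≤m+n p p)))))

rowSum-midpoint : ∀ {N p} (v : Fin N) → suc (suc (suc (p + p))) ≡ N → Central N (suc p) v →
  ((adjP N ^M suc (suc p)) ·𝟏) v ≡ 2 ^ suc (suc p) ∸ 2
rowSum-midpoint {p = p} v refl cv = begin
  ((adjP N ^M suc (suc p)) ·𝟏) v
    ≡⟨ rowSum-central (suc (suc p)) v cv ⟩
  pathAdj N (walksFrom (pathAdj N) (suc p)) (suc p)
    ≡⟨ pathAdj-midpoint p (fold-pathAdj-reflected (λ _ _ _ → refl) (suc p)) ⟩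
  walksFrom (pathAdj N) (suc p) p + walksFrom (pathAdj N) (suc p) p
    ≡⟨ cong (λ x → x + x) (fold-pathAdj-local (const 1) (suc p) (p+[1+p]<3+2p p)) ⟩
  walksFrom halfLineAdj (suc p) p + walksFrom halfLineAdj (suc p) p
    ≡⟨ 1+m≡n⇒m+m≡n+n∸2 (walksFrom-halfLine-edge p) ⟩
  2 ^ suc p + 2 ^ suc p ∸ 2
    ≡⟨ cong (_∸ 2) (2^k+2^k≡2^[1+k] (suc p)) ⟩
  2 ^ suc (suc p) ∸ 2 ∎
  where N = suc (suc (suc (p + p)))

diagonal-midpoint : ∀ {N p} (v : Fin N) → suc (suc (suc (p + p))) ≡ N → Central N (suc p) v →
  (adjP N ^M (2 * suc (suc p))) v v ≡ (2 * suc (suc p)) C suc (suc p) ∸ 2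
diagonal-midpoint {p = p} v refl cv = begin
  (adjP N ^M (2 * suc q)) v v
    ≡⟨ diagonal-central (2 * suc q) v cv ⟩
  walks (pathAdj N) (2 * suc q) q q
    ≡⟨ cong (λ k → walks (pathAdj N) k q q) (2*[1+q]≡2+q+q q) ⟩
  pathAdj N (λ x → walks (pathAdj N) K x q) q
    ≡⟨ pathAdj-midpoint p (fold-pathAdj-reflected (δ-reflected q q K≡N) K) ⟩
  walks (pathAdj N) K p q + walks (pathAdj N) K p q
    ≡⟨ cong (λ x → x + x) (fold-pathAdj-local-vanishing N (δ-vanishesAbove q) K bound) ⟩
  walks halfLineAdj K p q + walks halfLineAdj K p q
    ≡⟨ 1+m≡n⇒m+m≡n+n∸2 (walks-halfLine-reflection p q) ⟩
  K C suc q + K C suc q ∸ 2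
    ≡⟨ cong (_∸ 2) (odd-binomial-double q) ⟩
  suc K C suc q ∸ 2
    ≡⟨ cong (λ k → k C suc q ∸ 2) (2*[1+q]≡2+q+q q) ⟨
  (2 * suc q) C suc q ∸ 2 ∎
  where
  q = suc p
  N = suc (suc (suc (p + p)))
  K = suc (suc (p + q))
  K≡N : K ≡ N
  K≡N = cong (suc ∘ suc) (+-suc p p)
  bound : p + q + K < N + N
  bound = +-mono-<-≤ (p+[1+p]<3+2p p) (≤-reflexive K≡N)

rowSum-nearLeaf : ∀ {N q} (w : Fin N) → Central N q w → q + suc q < N →
  ((adjP N ^M suc q) ·𝟏) w ≡ 2 ^ suc q ∸ 1
rowSum-nearLeaf {q = q} w cw bound =
  trans (rowSum-halfLine w cw bound) (cong (_∸ 1) (walksFrom-halfLine-edge q))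

diagonal-nearLeaf : ∀ {N q} (w : Fin N) → Central N q w → q + q + 2 * suc q < N + N →
  (adjP N ^M (2 * suc q)) w w ≡ (2 * suc q) C suc q ∸ 1
diagonal-nearLeaf {q = q} w cw bound = begin
  (adjP _ ^M (2 * suc q)) w w              ≡⟨ diagonal-halfLine w cw bound ⟩
  walks halfLineAdj (2 * suc q) q q        ≡⟨ cong (λ k → walks halfLineAdj k q q) (2*[1+q]≡2+q+q q) ⟩
  walks halfLineAdj (suc (suc (q + q))) q q ≡⟨ cong (_∸ 1) (walks-halfLine-reflection q q) ⟩
  suc (suc (q + q)) C suc q ∸ 1            ≡⟨ cong (λ k → k C suc q ∸ 1) (2*[1+q]≡2+q+q q) ⟨
  (2 * suc q) C suc q ∸ 1                  ∎

proposition4p6 : (m n c : ℕ) → 1 ≤ m → 2 ≤ n →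
    (v : Fin (2 * n ∸ 1)) → (w : Fin (2 * n ∸ 1 + 2 ^ m)) →
    Central (2 * n ∸ 1) c v → Central (2 * n ∸ 1 + 2 ^ m) c w →
    ((c ≡ n ∸ 1 →
        (((adjP (2 * n ∸ 1) ^M n) ·𝟏) v ≡ 2 ^ n ∸ 2)
      × ((adjP (2 * n ∸ 1) ^M (2 * n)) v v ≡ (2 * n) C n ∸ 2)
      × (((adjP (2 * n ∸ 1 + 2 ^ m) ^M n) ·𝟏) w ≡ 2 ^ n ∸ 1)
      × ((adjP (2 * n ∸ 1 + 2 ^ m) ^M (2 * n)) w w ≡ (2 * n) C n ∸ 1))
    × ((k : ℕ) → c < n ∸ 1 → k ≤ n →
        ((adjP (2 * n ∸ 1) ^M k) ·𝟏) v ≡ ((adjP (2 * n ∸ 1 + 2 ^ m) ^M k) ·𝟏) w)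
    × ((k : ℕ) → c ≤ n ∸ 1 → k ≤ 2 * n ∸ 1 →
        (adjP (2 * n ∸ 1) ^M k) v v ≡ (adjP (2 * n ∸ 1 + 2 ^ m) ^M k) w w)
    × (c < n ∸ 1 →
        (adjP (2 * n ∸ 1) ^M (2 * n)) v v ≡ (adjP (2 * n ∸ 1 + 2 ^ m) ^M (2 * n)) w w))
proposition4p6 m (suc (suc p)) c _ (s≤s (s≤s z≤n)) v w cv cw =
    (λ { refl → rowSum-midpoint v N₁-odd cv , diagonal-midpoint v N₁-odd cv
              , rowSum-nearLeaf w cw (≤-<-trans (≤-reflexive q+n≡N₁) N₁<N₂)
              , diagonal-nearLeaf w cw (≤-<-trans (≤-reflexive 2q+2n≡2N₁) (+-mono-< N₁<N₂ N₁<N₂)) })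
  , (λ k c<q k≤n → rowSums (<-≤-trans (+-mono-<-≤ c<q k≤n) (≤-reflexive q+n≡N₁)))
  , (λ k c≤q k≤N₁ →
       diagonals (<-≤-trans (+-mono-≤-< (+-mono-≤ c≤q c≤q) (s≤s k≤N₁)) (≤-reflexive 2q+2n≡2N₁)))
  , (λ c<q → diagonals (<-≤-trans (+-monoˡ-< (2 * n) (+-mono-< c<q c<q)) (≤-reflexive 2q+2n≡2N₁)))
  where
  q = suc p
  n = suc q
  N₁ = 2 * n ∸ 1
  N₂ = N₁ + 2 ^ m
  q+n≡N₁ : q + n ≡ N₁
  q+n≡N₁ = cong (q +_) (sym (+-identityʳ n))
  N₁-odd : suc (suc (suc (p + p))) ≡ N₁
  N₁-odd = trans (cong suc (sym (trans (+-suc p (suc p)) (cong suc (+-suc p p))))) q+n≡N₁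
  regroup : ∀ a b → a + a + 2 * b ≡ a + b + (a + b)
  regroup = solve-∀
  2q+2n≡2N₁ : q + q + 2 * n ≡ N₁ + N₁
  2q+2n≡2N₁ = trans (regroup q n) (cong₂ _+_ q+n≡N₁ q+n≡N₁)
  N₁<N₂ : N₁ < N₂
  N₁<N₂ = m<m+n N₁ (m^n>0 2 m)
  rowSums : ∀ {k} → c + k < N₁ → ((adjP N₁ ^M k) ·𝟏) v ≡ ((adjP N₂ ^M k) ·𝟏) w
  rowSums bound = trans (rowSum-halfLine v cv bound) (sym (rowSum-halfLine w cw (<-trans bound N₁<N₂)))
  diagonals : ∀ {k} → c + c + k < N₁ + N₁ → (adjP N₁ ^M k) v v ≡ (adjP N₂ ^M k) w w
  diagonals bound =
    trans (diagonal-halfLine v cv bound)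
          (sym (diagonal-halfLine w cw (<-trans bound (+-mono-< N₁<N₂ N₁<N₂))))
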